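{- Let $\varphi$ be an LTL formula over a finite set of propositional variables $V = I \cup O$ ($I \cap O = \emptyset$), let $X \subseteq O$ and $Y \subseteq I \cup O$, and let $A_\varphi$ be a nondeterministic Büchi automaton over the alphabet $\Sigma = 2^V$ with $L(A_\varphi) = L(\varphi)$ in which every state and every transition lies on some accepting run. Then $X$ is dependent on $Y$ in $\varphi$ if and only if $X$ is automata dependent on $Y$ in $A_\varphi$.
   Context: Letters of $\Sigma = 2^V$ are assignments to $V$. For a letter $a$ and $Z \subseteq V$, $a.Z$ denotes the restriction (projection) of $a$ to $Z$. For an infinite word $w = w_0 w_1 \cdots$, $w[0,i] = w_0\cdots w_i$, and $w[0,-1]$ is the empty word. $L(\varphi) \subseteq \Sigma^\omega$ is the set of infinite words satisfying $\varphi$. Dependency in LTL: $X$ is dependent on $Y$ in $\varphi$ if for every $w, w' \in L(\varphi)$ and every $i \ge 0$, if $w[0,i-1] = w'[0,i-1]$ and $w_i.Y = w'_i.Y$ then $w_i.X = w'_i.X$. An NBA is $A = (\Sigma, Q, \delta, q_0, F)$ with $\delta : Q \times \Sigma \to 2^Q$; a run is a path from $q_0$, accepting if it visits $F$ infinitely often; $L(A)$ is the set of words having an accepting run. A pair of states $(s,s')$ is compatible in $A$ if there is a finite word $u \in \Sigma^*$ with runs from $q_0$ to $s$ and from $q_0$ to $s'$ both reading $u$. Automata dependency: $X$ is automata dependent on $Y$ in $A$ if for every compatible pair $(s,s')$ and all letters $\sigma, \sigma' \in \Sigma$ with $\sigma.Y = \sigma'.Y$ and $\sigma.X \neq \sigma'.X$,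 it is not the case that both $\delta(s,\sigma) \neq \emptyset$ and $\delta(s',\sigma') \neq \emptyset$. -}

module Defs where

open import Data.Nat using (ℕ; zero; suc; _≤_; _<_)
open import Data.Fin using (Fin)
open import Data.Fin.Subset using (Subset; _∈_; _∉_)
open import Data.Vec using (lookup)
open import Data.Bool using (Bool)
open import Data.List using (List; []; _∷_)
open import Data.Product using (Σ; ∃; _×_; _,_)
open import Data.Unit using (⊤)
open import Data.Empty using (⊥)
open import Relation.Binary.PropositionalEquality using (_≡_)
open import Relation.Nullary using (¬_)

-- Propositional variables: V = Fin n.  Letters of Σ = 2^V are subsets of V
-- (equivalently assignments V → Bool), represented as Subset n = Vec Bool n.
Letter : ℕ → Set
Letter n = Subset n

Word : ℕ → Set
Word n = ℕ → Letter n

_≡[_]_ : ∀ {n} → Letter n → Subset n → Letter n → Set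
a ≡[ Z ] b = ∀ v → v ∈ Z → lookup a v ≡ lookup b v

SamePrefix : ∀ {n} → Word n → Word n → ℕ → Set
SamePrefix w w' i = ∀ j → j < i → w j ≡ w' j

data LTL (n : ℕ) : Set where
  tt    : LTL n
  atom  : Fin n → LTL n
  ¬'_   : LTL n → LTL n
  _∧'_  : LTL n → LTL n → LTL n
  X'_   : LTL n → LTL n
  _U'_  : LTL n → LTL n → LTL n

_,_⊨_ : ∀ {n} → Word n → ℕ → LTL n → Set
w , i ⊨ tt = ⊤
w , i ⊨ atom p = p ∈ w i
w , i ⊨ (¬' φ) = ¬ (w , i ⊨ φ)
w , i ⊨ (φ ∧' ψ) = (w , i ⊨ φ) × (w , i ⊨ ψ)
w , i ⊨ (X' φ) = w , suc i ⊨ φ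
w , i ⊨ (φ U' ψ) =
  Σ ℕ λ k → (i ≤ k) × (w , k ⊨ ψ) × (∀ j → i ≤ j → j < k → w , j ⊨ φ)

_∈L_ : ∀ {n} → Word n → LTL n → Set
w ∈L φ = w , 0 ⊨ φ

Dependent : ∀ {n} → LTL n → Subset n → Subset n → Set
Dependent φ X Y =
  ∀ w w' → w ∈L φ → w' ∈L φ → ∀ i →
    SamePrefix w w' i → w i ≡[ Y ] w' i → w i ≡[ X ] w' i

record NBA (n : ℕ) : Set where
  field
    m  : ℕ
    δ  : Fin m → Letter n → Subset m
    q₀ : Fin m
    F  : Subset m

module _ {n : ℕ} (A : NBA n) where
  open NBA A

  IsRun : Word n → (ℕ → Fin m) → Set
  IsRun w r = (r 0 ≡ q₀) × (∀ i → r (suc i) ∈ δ (r i) (w i))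

  IsAccepting : (ℕ → Fin m) → Set
  IsAccepting r = ∀ k → Σ ℕ λ j → (k ≤ j) × (r j ∈ F)

  IsAcceptingRun : Word n → (ℕ → Fin m) → Set
  IsAcceptingRun w r = IsRun w r × IsAccepting r

  Accepts : Word n → Set
  Accepts w = Σ (ℕ → Fin m) λ r → IsAcceptingRun w r

  data Path : Fin m → List (Letter n) → Fin m → Set where
    nil  : ∀ {q} → Path q [] q
    cons : ∀ {q q' q'' a u} → q' ∈ δ q a → Path q' u q'' → Path q (a ∷ u) q''

  Compatible : Fin m → Fin m → Set
  Compatible s s' = Σ (List (Letter n)) λ u → Path q₀ u s × Path q₀ u s'

  NonEmpty : Fin m → Letter n → Set
  NonEmpty s σ = Σ (Fin m) λ q → q ∈ δ s σ

  AutDependent : Subset n → Subset n → Set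
  AutDependent X Y =
    ∀ s s' → Compatible s s' → ∀ σ σ' → σ ≡[ Y ] σ' → ¬ (σ ≡[ X ] σ') →
      ¬ (NonEmpty s σ × NonEmpty s' σ')

  StatesUseful : Set
  StatesUseful = ∀ q → Σ (Word n) λ w → Σ (ℕ → Fin m) λ r →
    IsAcceptingRun w r × Σ ℕ λ i → r i ≡ q

  TransitionsUseful : Set
  TransitionsUseful = ∀ s σ s' → s' ∈ δ s σ →
    Σ (Word n) λ w → Σ (ℕ → Fin m) λ r → IsAcceptingRun w r ×
      Σ ℕ λ i → (r i ≡ s) × (w i ≡ σ) × (r (suc i) ≡ s')

{-# OPTIONS --safe #-}
-- (⇒) If states s, s' are reached on a common word u and enable letters σ, σ',
-- usefulness of those transitions extends u σ and u σ' to accepted words, i.e.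
-- to two words of L(φ) with common prefix u; dependency in φ then forces
-- σ.X = σ'.X.
-- (⇐) Runs of two words of L(φ) agreeing before position i reach a compatible
-- pair (r i, r' i) enabling w_i and w'_i, so automata dependency rules out
-- w_i.X ≠ w'_i.X; as letters are Boolean vectors, this yields w_i.X = w'_i.X.
module Submission where

open import Defs
open import Data.Nat using (ℕ; zero; suc; _+_; _∸_; z≤n; s≤s)
open import Data.Nat.Properties using (m≤n⇒m≤1+n; m+n≤o⇒m≤o∸n; m+n≤o⇒n≤o; m∸n+n≡m)
open import Data.Fin using (Fin)
open import Data.Fin.Subset using (Subset; _⊆_; _∪_; Empty; _∩_; _∈_)
open import Data.Fin.Subset using (⊤)
open import Data.Product using (_×_; _,_; ∃)
open import Data.List using (List; []; _∷_; length)
open import Data.Bool.Properties using () renaming (_≟_ to _≟ᵇ_)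
open import Data.Vec using (lookup)
open import Function using (_∘_)
open import Function.Bundles using (_⇔_; mk⇔; Equivalence)
open import Relation.Nullary.Decidable using (decidable-stable)
open import Relation.Binary.PropositionalEquality using (_≡_; refl; sym; trans; cong; cong₂; subst)

module _ {A : Set} where

  take : ℕ → (ℕ → A) → List A
  take zero    w = []
  take (suc i) w = w 0 ∷ take i (w ∘ suc)

  -- Adding i on the right makes drop i w (suc k) reduce to w (suc (k + i)).
  drop : ℕ → (ℕ → A) → ℕ → A
  drop i w k = w (k + i)

  _++ω_ : List A → (ℕ → A) → ℕ → A
  ([]      ++ω w) k       = w k
  ((a ∷ u) ++ω w) zero    = a
  ((a ∷ u) ++ω w) (suc k) = (u ++ω w) k

  ++ω-length : ∀ (u : List A) w → (u ++ω w) (length u) ≡ w 0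
  ++ω-length []      w = refl
  ++ω-length (a ∷ u) w = ++ω-length u w

module _ {n : ℕ} where

  ++ω-samePrefix : ∀ (u : List (Letter n)) w w' → SamePrefix (u ++ω w) (u ++ω w') (length u)
  ++ω-samePrefix (a ∷ u) w w' zero    _        = refl
  ++ω-samePrefix (a ∷ u) w w' (suc j) (s≤s j<) = ++ω-samePrefix u w w' j j<

  samePrefix⇒take≡ : ∀ (w w' : Word n) i → SamePrefix w w' i → take i w ≡ take i w'
  samePrefix⇒take≡ w w' zero    _    = refl
  samePrefix⇒take≡ w w' (suc i) same =
    cong₂ _∷_ (same 0 (s≤s z≤n)) (samePrefix⇒take≡ (w ∘ suc) (w' ∘ suc) i (λ j → same (suc j) ∘ s≤s))

module _ {n : ℕ} (A : NBA n) where
  open NBA A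

  IsRunFrom : Fin m → Word n → (ℕ → Fin m) → Set
  IsRunFrom q w r = (r 0 ≡ q) × (∀ i → r (suc i) ∈ δ (r i) (w i))

  runFrom⇒path : ∀ {q w r} → IsRunFrom q w r → ∀ i → Path A q (take i w) (r i)
  runFrom⇒path (refl , _)    zero    = nil
  runFrom⇒path (refl , step) (suc i) = cons (step 0) (runFrom⇒path (refl , step ∘ suc) i)

  drop-isRunFrom : ∀ {q w r} → IsRunFrom q w r → ∀ i → IsRunFrom (r i) (drop i w) (drop i r)
  drop-isRunFrom (_ , step) i = refl , λ k → step (k + i)

  drop-accepting : ∀ {r} → IsAccepting A r → ∀ i → IsAccepting A (drop i r)
  drop-accepting {r} acc i k with acc (k + i)
  ... | j , k+i≤j , rj∈F =
    j ∸ i , m+n≤o⇒m≤o∸n k k+i≤j ,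
    subst (_∈ F) (sym (cong r (m∸n+n≡m (m+n≤o⇒n≤o k k+i≤j)))) rj∈F

  accepting-fromTail : ∀ {r} → IsAccepting A (r ∘ suc) → IsAccepting A r
  accepting-fromTail acc k with acc k
  ... | j , k≤j , rj∈F = suc j , m≤n⇒m≤1+n k≤j , rj∈F

  prependRun : ∀ {q u q'} → Path A q u q' → (ℕ → Fin m) → ℕ → Fin m
  prependRun nil                ρ k       = ρ k
  prependRun (cons {q = q} _ _) ρ zero    = q
  prependRun (cons _ p)         ρ (suc k) = prependRun p ρ k

  prependRun-isRunFrom : ∀ {q u q' w ρ} (p : Path A q u q') →
    IsRunFrom q' w ρ → IsRunFrom q (u ++ω w) (prependRun p ρ)
  prependRun-isRunFrom nil        run = run
  prependRun-isRunFrom (cons d p) run with prependRun-isRunFrom p run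
  ... | start , step = refl , λ { zero → subst (_∈ δ _ _) (sym start) d ; (suc k) → step k }

  prependRun-accepting : ∀ {q u q' ρ} (p : Path A q u q') →
    IsAccepting A ρ → IsAccepting A (prependRun p ρ)
  prependRun-accepting nil        acc = acc
  prependRun-accepting (cons _ p) acc = accepting-fromTail (prependRun-accepting p acc)

  transition⇒acceptedExtension : TransitionsUseful A → ∀ {s u q σ} →
    Path A q₀ u s → q ∈ δ s σ →
    ∃ λ v → ((u ++ω v) (length u) ≡ σ) × Accepts A (u ++ω v)
  transition⇒acceptedExtension useful {s} {u} {q} {σ} p d with useful s σ q d
  ... | w , r , (run , acc) , i , refl , wi≡σ , _ =
    drop i w , trans (++ω-length u (drop i w)) wi≡σ ,
    prependRun p (drop i r) ,
    prependRun-isRunFrom p (drop-isRunFrom run i) , prependRun-accepting p (drop-accepting acc i)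

  runs⇒compatible : ∀ {w w' r r'} → IsRun A w r → IsRun A w' r' → ∀ i →
    SamePrefix w w' i → Compatible A (r i) (r' i)
  runs⇒compatible {w} {w'} {r' = r'} run run' i same =
    take i w , runFrom⇒path run i ,
    subst (λ u → Path A q₀ u (r' i)) (sym (samePrefix⇒take≡ w w' i same)) (runFrom⇒path run' i)

  run⇒nonEmpty : ∀ {w r} → IsRun A w r → ∀ i → NonEmpty A (r i) (w i)
  run⇒nonEmpty {r = r} (_ , step) i = r (suc i) , step i

  module _ {φ : LTL n} {X Y : Subset n} where

    dependent⇒autDependent : TransitionsUseful A → (∀ w → Accepts A w → w ∈L φ) →
      Dependent φ X Y → AutDependent A X Y
    dependent⇒autDependent useful sound dep s s' (u , p , p') σ σ' σ≡Yσ' σ≢Xσ' ((q , d) , (q' , d'))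
      with transition⇒acceptedExtension useful p d | transition⇒acceptedExtension useful p' d'
    ... | v , refl , acc | v' , refl , acc' =
      σ≢Xσ' (dep (u ++ω v) (u ++ω v') (sound _ acc) (sound _ acc') (length u)
                 (++ω-samePrefix u v v') σ≡Yσ')

    -- Only the existence of runs on words of L(φ) is needed, not their acceptance.
    autDependent⇒dependent : (∀ w → w ∈L φ → Accepts A w) →
      AutDependent A X Y → Dependent φ X Y
    autDependent⇒dependent complete autDep w w' w∈φ w'∈φ i same wi≡Yw'i x x∈X
      with complete w w∈φ | complete w' w'∈φ
    ... | r , (run , _) | r' , (run' , _) =
      decidable-stable (lookup (w i) x ≟ᵇ lookup (w' i) x) λ wi≢w'i-at-x →
        autDep (r i) (r' i) (runs⇒compatible run run' i same) (w i) (w' i) wi≡Yw'i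
          (λ wi≡Xw'i → wi≢w'i-at-x (wi≡Xw'i x x∈X))
          (run⇒nonEmpty run i , run⇒nonEmpty run' i)

theorem2 : ∀ {n : ℕ} (I O X Y : Subset n) (φ : LTL n) (A : NBA n) →
    Empty (I ∩ O) → I ∪ O ≡ ⊤ → X ⊆ O → Y ⊆ I ∪ O →
    (∀ w → Accepts A w ⇔ w ∈L φ) →
    StatesUseful A → TransitionsUseful A →
    Dependent φ X Y ⇔ AutDependent A X Y
theorem2 I O X Y φ A _ _ _ _ L[A]≡L[φ] _ transitionsUseful =
  mk⇔ (dependent⇒autDependent A {φ} transitionsUseful (λ w → Equivalence.to (L[A]≡L[φ] w)))
      (autDependent⇒dependent A {φ} (λ w → Equivalence.from (L[A]≡L[φ] w)))
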